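{- Let $a,b$ be positive integers and $t\ge a+1$, $s\ge b+1$. Then \[ R^{a+b+1}\big(TK^{(a+1)}_t, TK^{(b+1)}_s\big)\le (t-a)(s-b)+a+b. \]
   Context: $K^{(m)}_n$ denotes the complete $m$-uniform hypergraph on $n$ vertices. For a hypergraph $\mathcal{H}'$ and a set $S\subseteq V(\mathcal{H}')$, the trace $\mathrm{Tr}(\mathcal{H}',S)$ is the hypergraph on $S$ with hyperedge set $\{h\cap S: h\in E(\mathcal{H}')\}$. For an $m$-uniform hypergraph $\mathcal{H}$ and $r\ge m$, $T\mathcal{H}$ is the set of $r$-uniform hypergraphs $\mathcal{H}'$ with $V(\mathcal{H})\subseteq V(\mathcal{H}')$ and $\mathrm{Tr}(\mathcal{H}',V(\mathcal{H}))=\mathcal{H}$. For collections $\mathcal{F}_1,\mathcal{F}_2$ of $r$-uniform hypergraphs, $R^r(\mathcal{F}_1,\mathcal{F}_2)$ is the least $N$ such that every 2-coloring of the hyperedges of the complete $r$-uniform hypergraph on $N$ vertices contains a subhypergraph of the first color isomorphic to a member of $\mathcal{F}_1$ or one of the second color isomorphic to a member of $\mathcal{F}_2$. Here $r=a+b+1$. -}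

module Defs where

open import Data.Nat using (ℕ; zero; suc; _+_; _*_; _∸_; _≤_)
open import Data.Bool using (Bool; true; false; _∧_; _∨_)
open import Data.Fin using (Fin; inject≤; _≟_)
open import Data.Fin.Subset using (Subset; ∣_∣)
open import Data.Vec using (tabulate; lookup)
open import Data.List using (List)
open import Data.List.Membership.Propositional using (_∈_)
open import Data.Product using (Σ; ∃; _×_; _,_)
open import Data.Sum using (_⊎_)
open import Function.Definitions using (Injective)
open import Relation.Binary.PropositionalEquality using (_≡_)
open import Relation.Nullary.Decidable using (⌊_⌋)

-- A finite hypergraph: vertex set Fin n, hyperedges a list of subsets of Fin n
-- (read as a set of hyperedges; repetitions are immaterial).
record Hypergraph : Set where
  constructor hg
  field
    n : ℕ
    E : List (Subset n)
open Hypergraph public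

Uniform : ℕ → Hypergraph → Set
Uniform r H = ∀ {e} → e ∈ E H → ∣ e ∣ ≡ r

restrict : ∀ {t n} → .(t ≤ n) → Subset n → Subset t
restrict le e = tabulate (λ i → lookup e (inject≤ i le))

-- H' ∈ T K^{(m)}_t with H' r-uniform: V(K_t) = the first t vertices of V(H'),
-- and Tr(H', V(K_t)) = K^{(m)}_t, i.e. {h ∩ S : h ∈ E(H')} equals the set of
-- all m-subsets of S.
TK : (m t r : ℕ) → Hypergraph → Set
TK m t r H =
  Σ (t ≤ n H) λ le →
    Uniform r H
    × (∀ {h} → h ∈ E H → ∣ restrict le h ∣ ≡ m)
    × (∀ (A : Subset t) → ∣ A ∣ ≡ m → ∃ λ h → h ∈ E H × restrict le h ≡ A)

anyFin : ∀ {n} → (Fin n → Bool) → Bool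
anyFin {zero}  p = false
anyFin {suc n} p = p Fin.zero ∨ anyFin (λ i → p (Fin.suc i))

image : ∀ {n N} → (Fin n → Fin N) → Subset n → Subset N
image f e = tabulate (λ j → anyFin (λ i → lookup e i ∧ ⌊ f i ≟ j ⌋))

-- A 2-colouring of the hyperedges of K^{(r)}_N: colour of each subset
-- (only the r-subsets are hyperedges; only their colours are ever used).
Colouring : ℕ → Set
Colouring N = Subset N → Bool

HasCopy : ∀ {N} → Colouring N → Bool → Hypergraph → Set
HasCopy {N} c col H =
  Σ (Fin (n H) → Fin N) λ f → Injective _≡_ _≡_ f × (∀ {e} → e ∈ E H → c (image f e) ≡ col)

RamseyProperty : (r : ℕ) → (Hypergraph → Set) → (Hypergraph → Set) → ℕ → Set
RamseyProperty r F₁ F₂ N =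
  (c : Colouring N) →
    (∃ λ H → F₁ H × HasCopy c true H) ⊎ (∃ λ H → F₂ H × HasCopy c false H)

-- R^r(F₁,F₂) ≤ M  :⇔  the least N with the Ramsey property is ≤ M
--                  ⇔  some N ≤ M has the Ramsey property.
RamseyLE : (r : ℕ) → (Hypergraph → Set) → (Hypergraph → Set) → ℕ → Set
RamseyLE r F₁ F₂ M = ∃ λ N → N ≤ M × RamseyProperty r F₁ F₂ N

{-# OPTIONS --safe #-}

-- Colour the r-sets of N = pq + a + b vertices, arranged as a p × q grid of cells
-- plus a lower block of a and an upper block of b vertices (r = a + b + 1).  Row i
-- of the grid together with the upper block spans b + q vertices.  If in some row
-- every (b+1)-subset is the trace of a false r-set, these r-sets form a false member
-- of T K^(b+1)_(b+q).  Otherwise every row i has a (b+1)-set B_i that is the trace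
-- of true r-sets only; B_i contains a cell (i, j_i).  The lower block together with
-- the transversal of cells (i, j_i) spans a + p vertices, and an (a+1)-subset A of
-- it contains some cell (i, j_i).  Since the transversal meets row i only in that
-- cell, B_i ∪ A is an r-set whose trace on row i is B_i, hence it is true, and whose
-- trace on the transversal is A: this gives a true member of T K^(a+1)_(a+p).

module Submission where

open import Defs
open import Data.Nat using (ℕ; zero; suc; _+_; _*_; _∸_; _≤_; _<_; s≤s)
import Data.Nat.Properties as ℕ
open import Data.Nat.Properties using (≤-refl; ≤-reflexive; ≤-trans; m≤m+n; m+[n∸m]≡n; +-suc; +-comm; <-trans; n<1+n)
open import Data.Nat.Tactic.RingSolver using (solve-∀)
open import Data.Bool using (Bool; true; false; _∧_; _∨_; not)
open import Data.Bool.Properties using (∧-conicalˡ; ∧-conicalʳ; ∧-identityʳ; ∧-zeroʳ; ∨-identityʳ; ¬-not; T-≡)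
import Data.Bool.Properties as Bool
open import Data.Fin using (Fin; zero; suc; inject≤; _↑ˡ_; _↑ʳ_; combine; remQuot; punchIn; punchOut)
open import Data.Fin.Properties using (_≟_; suc-injective; all?; injective⇒≤; remQuot-combine; punchOut-injective; punchIn-punchOut)
open import Data.Fin.Permutation using (Permutation′; _⟨$⟩ʳ_; _⟨$⟩ˡ_; inverseʳ; insert; id)
open import Data.Fin.Subset using (Subset; ∣_∣; _∪_)
open import Data.Fin.Subset.Properties using (anySubset?)
open import Data.Vec using ([]; _∷_; tabulate; lookup; _[_]≔_)
open import Data.Vec.Properties using (lookup∘tabulate; tabulate∘lookup; tabulate-cong; lookup-zipWith; lookup∘update; lookup∘update′; []≔-lookup)
open import Data.Vec.Functional using (_++_)
open import Data.Vec.Functional.Properties using (lookup-++ˡ; lookup-++ʳ)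
open import Data.List using (List; [_])
import Data.List as List
open import Data.List.Membership.Propositional using (_∈_)
open import Data.List.Membership.Propositional.Properties using (∈-map⁺; ∈-++⁺ˡ; ∈-++⁺ʳ; ∈-filter⁺; ∈-filter⁻)
open import Data.List.Relation.Unary.Any using (here)
open import Data.Product using (∃; _×_; _,_; proj₁; proj₂; uncurry)
open import Data.Sum using (_⊎_; inj₁; inj₂)
open import Data.Empty using (⊥-elim)
open import Function using (_∘_; case_of_)
open import Function.Definitions using (Injective)
open import Function.Bundles using (Injection; Equivalence)
open import Function.Properties.Inverse using (↔⇒↣)
open import Relation.Binary.PropositionalEquality using (_≡_; _≢_; refl; sym; trans; cong; cong₂; subst; subst₂; module ≡-Reasoning)
open import Relation.Nullary using (Dec; yes; no; ¬?; _×-dec_)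
open import Relation.Nullary.Decidable using (⌊_⌋; toWitness; dec-yes; dec-no; decidable-stable)

open ≡-Reasoning

private variable
  s N : ℕ

⌊≟⌋-refl : (x : Fin s) → ⌊ x ≟ x ⌋ ≡ true
⌊≟⌋-refl x = cong ⌊_⌋ (proj₂ (dec-yes (x ≟ x) refl))

⌊≟⌋-≢ : {x y : Fin s} → x ≢ y → ⌊ x ≟ y ⌋ ≡ false
⌊≟⌋-≢ {x = x} {y} x≢y = cong ⌊_⌋ (dec-no (x ≟ y) x≢y)

⌊≟⌋≡true⇒≡ : {x y : Fin s} → ⌊ x ≟ y ⌋ ≡ true → x ≡ y
⌊≟⌋≡true⇒≡ x≟y = toWitness (Equivalence.from T-≡ x≟y)

lookup-ext : {p q : Subset s} → (∀ k → lookup p k ≡ lookup q k) → p ≡ q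
lookup-ext {p = p} {q} p≗q = begin
  p                  ≡⟨ tabulate∘lookup p ⟨
  tabulate (lookup p) ≡⟨ tabulate-cong p≗q ⟩
  tabulate (lookup q) ≡⟨ tabulate∘lookup q ⟩
  q                  ∎

∣p[x]≔true∣≡suc∣p[x]≔false∣ : (p : Subset s) (x : Fin s) →
                              ∣ p [ x ]≔ true ∣ ≡ suc ∣ p [ x ]≔ false ∣
∣p[x]≔true∣≡suc∣p[x]≔false∣ (_     ∷ p) zero    = refl
∣p[x]≔true∣≡suc∣p[x]≔false∣ (true  ∷ p) (suc x) = cong suc (∣p[x]≔true∣≡suc∣p[x]≔false∣ p x)
∣p[x]≔true∣≡suc∣p[x]≔false∣ (false ∷ p) (suc x) = ∣p[x]≔true∣≡suc∣p[x]≔false∣ p x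

∣p∣≡suc∣p[x]≔false∣ : (p : Subset s) {x : Fin s} → lookup p x ≡ true → ∣ p ∣ ≡ suc ∣ p [ x ]≔ false ∣
∣p∣≡suc∣p[x]≔false∣ p {x} x∈p = begin
  ∣ p ∣                      ≡⟨ cong ∣_∣ ([]≔-lookup p x) ⟨
  ∣ p [ x ]≔ lookup p x ∣    ≡⟨ cong (λ b → ∣ p [ x ]≔ b ∣) x∈p ⟩
  ∣ p [ x ]≔ true ∣          ≡⟨ ∣p[x]≔true∣≡suc∣p[x]≔false∣ p x ⟩
  suc ∣ p [ x ]≔ false ∣     ∎

∣p[x]≔true∣≡suc∣p∣ : (p : Subset s) {x : Fin s} → lookup p x ≡ false → ∣ p [ x ]≔ true ∣ ≡ suc ∣ p ∣
∣p[x]≔true∣≡suc∣p∣ p {x} x∉p = begin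
  ∣ p [ x ]≔ true ∣          ≡⟨ ∣p[x]≔true∣≡suc∣p[x]≔false∣ p x ⟩
  suc ∣ p [ x ]≔ false ∣     ≡⟨ cong (λ b → suc ∣ p [ x ]≔ b ∣) x∉p ⟨
  suc ∣ p [ x ]≔ lookup p x ∣ ≡⟨ cong (suc ∘ ∣_∣) ([]≔-lookup p x) ⟩
  suc ∣ p ∣                  ∎

∣p∪q∣≡∣p∣+∣q∣ : (p q : Subset s) → (∀ k → lookup p k ∧ lookup q k ≡ false) →
                ∣ p ∪ q ∣ ≡ ∣ p ∣ + ∣ q ∣
∣p∪q∣≡∣p∣+∣q∣ []      []      _        = refl
∣p∪q∣≡∣p∣+∣q∣ (x ∷ p) (y ∷ q) disjoint with x | y | disjoint zero
... | true  | false | _ = cong suc (∣p∪q∣≡∣p∣+∣q∣ p q (disjoint ∘ suc))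
... | false | true  | _ = trans (cong suc (∣p∪q∣≡∣p∣+∣q∣ p q (disjoint ∘ suc))) (sym (+-suc ∣ p ∣ ∣ q ∣))
... | false | false | _ = ∣p∪q∣≡∣p∣+∣q∣ p q (disjoint ∘ suc)

anyFin-true⁻ : (p : Fin s → Bool) → anyFin p ≡ true → ∃ λ i → p i ≡ true
anyFin-true⁻ {suc s} p any with p zero in p₀
... | true  = zero , p₀
... | false = let i , pᵢ = anyFin-true⁻ (p ∘ suc) any in suc i , pᵢ

anyFin-false : (p : Fin s → Bool) → (∀ i → p i ≡ false) → anyFin p ≡ false
anyFin-false {zero}  p _    = refl
anyFin-false {suc s} p p≡ff rewrite p≡ff zero = anyFin-false (p ∘ suc) (p≡ff ∘ suc)

anyFin-single : (p : Fin s → Bool) {k : Fin s} → (∀ i → i ≢ k → p i ≡ false) → anyFin p ≡ p k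
anyFin-single {suc s} p {zero} only-0 = begin
  p zero ∨ anyFin (p ∘ suc)   ≡⟨ cong (p zero ∨_) (anyFin-false (p ∘ suc) λ i → only-0 (suc i) λ ()) ⟩
  p zero ∨ false              ≡⟨ ∨-identityʳ _ ⟩
  p zero                      ∎
anyFin-single {suc s} p {suc k} only-k rewrite only-k zero (λ ()) =
  anyFin-single (p ∘ suc) λ i i≢k → only-k (suc i) (i≢k ∘ suc-injective)

module _ {N} (f : Fin s → Fin N) where

  lookup-image : (e : Subset s) (v : Fin N) →
                 lookup (image f e) v ≡ anyFin (λ i → lookup e i ∧ ⌊ f i ≟ v ⌋)
  lookup-image e v = lookup∘tabulate _ v

  lookup-image-true⁻ : (e : Subset s) {v : Fin N} → lookup (image f e) v ≡ true →
                       ∃ λ i → lookup e i ≡ true × f i ≡ v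
  lookup-image-true⁻ e {v} v∈fe =
    let i , hit = anyFin-true⁻ _ (trans (sym (lookup-image e v)) v∈fe)
    in i , ∧-conicalˡ _ _ hit , ⌊≟⌋≡true⇒≡ (∧-conicalʳ _ _ hit)

  lookup-image-false⁺ : (e : Subset s) {v : Fin N} → (∀ i → f i ≡ v → lookup e i ≡ false) →
                        lookup (image f e) v ≡ false
  lookup-image-false⁺ e {v} outside with lookup (image f e) v in v∈fe
  ... | false = refl
  ... | true  = let i , i∈e , fi≡v = lookup-image-true⁻ e v∈fe in
                case trans (sym (outside i fi≡v)) i∈e of λ ()

  lookup-image-injective : Injective _≡_ _≡_ f → (e : Subset s) (k : Fin s) →
                           lookup (image f e) (f k) ≡ lookup e k
  lookup-image-injective f-inj e k = begin
    lookup (image f e) (f k)                     ≡⟨ lookup-image e (f k) ⟩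
    anyFin (λ i → lookup e i ∧ ⌊ f i ≟ f k ⌋)    ≡⟨ anyFin-single _ others ⟩
    lookup e k ∧ ⌊ f k ≟ f k ⌋                   ≡⟨ cong (lookup e k ∧_) (⌊≟⌋-refl (f k)) ⟩
    lookup e k ∧ true                            ≡⟨ ∧-identityʳ _ ⟩
    lookup e k                                   ∎
    where
    others : ∀ i → i ≢ k → lookup e i ∧ ⌊ f i ≟ f k ⌋ ≡ false
    others i i≢k = trans (cong (lookup e i ∧_) (⌊≟⌋-≢ (i≢k ∘ f-inj))) (∧-zeroʳ _)

image-true∷ : (f : Fin (suc s) → Fin N) (e : Subset s) →
              image f (true ∷ e) ≡ image (f ∘ suc) e [ f zero ]≔ true
image-true∷ f e = lookup-ext λ v → trans (lookup-image f (true ∷ e) v) (pointwise v)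
  where
  pointwise : ∀ v → ⌊ f zero ≟ v ⌋ ∨ anyFin (λ i → lookup e i ∧ ⌊ f (suc i) ≟ v ⌋) ≡
                    lookup (image (f ∘ suc) e [ f zero ]≔ true) v
  pointwise v with f zero ≟ v
  ... | yes refl = sym (lookup∘update (f zero) (image (f ∘ suc) e) true)
  ... | no  f₀≢v = sym (trans (lookup∘update′ (f₀≢v ∘ sym) (image (f ∘ suc) e) true)
                              (lookup-image (f ∘ suc) e v))

∣image∣ : {f : Fin s → Fin N} → Injective _≡_ _≡_ f → (e : Subset s) → ∣ image f e ∣ ≡ ∣ e ∣
∣image∣ {N = N} _ [] = nothing N
  where
  nothing : ∀ N → ∣ tabulate {n = N} (λ _ → false) ∣ ≡ 0
  nothing zero    = refl
  nothing (suc N) = nothing N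
∣image∣ f-inj (false ∷ e) = ∣image∣ (suc-injective ∘ f-inj) e
∣image∣ {f = f} f-inj (true ∷ e) = begin
  ∣ image f (true ∷ e) ∣                     ≡⟨ cong ∣_∣ (image-true∷ f e) ⟩
  ∣ image (f ∘ suc) e [ f zero ]≔ true ∣     ≡⟨ ∣p[x]≔true∣≡suc∣p∣ (image (f ∘ suc) e) f₀∉ ⟩
  suc ∣ image (f ∘ suc) e ∣                  ≡⟨ cong suc (∣image∣ (suc-injective ∘ f-inj) e) ⟩
  suc ∣ e ∣                                  ∎
  where
  f₀∉ : lookup (image (f ∘ suc) e) (f zero) ≡ false
  f₀∉ = lookup-image-false⁺ (f ∘ suc) e λ i fᵢ≡f₀ → case f-inj fᵢ≡f₀ of λ ()

preimage : (Fin s → Fin N) → Subset N → Subset s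
preimage f h = tabulate (lookup h ∘ f)

⟨$⟩ʳ-injective : (π : Permutation′ N) → Injective _≡_ _≡_ (π ⟨$⟩ʳ_)
⟨$⟩ʳ-injective π = Injection.injective (↔⇒↣ π)

image-preimage : (π : Permutation′ N) (h : Subset N) → image (π ⟨$⟩ʳ_) (preimage (π ⟨$⟩ʳ_) h) ≡ h
image-preimage π h = lookup-ext λ v → begin
  lookup (image σ e) v                 ≡⟨ cong (lookup (image σ e)) (inverseʳ π) ⟨
  lookup (image σ e) (σ (π ⟨$⟩ˡ v))    ≡⟨ lookup-image-injective σ (⟨$⟩ʳ-injective π) e (π ⟨$⟩ˡ v) ⟩
  lookup e (π ⟨$⟩ˡ v)                  ≡⟨ lookup∘tabulate _ (π ⟨$⟩ˡ v) ⟩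
  lookup h (σ (π ⟨$⟩ˡ v))              ≡⟨ cong (lookup h) (inverseʳ π) ⟩
  lookup h v                           ∎
  where
  σ = π ⟨$⟩ʳ_
  e = preimage σ h

extend-injection : {t : ℕ} {g : Fin t → Fin N} → Injective _≡_ _≡_ g → (t≤N : t ≤ N) →
                   ∃ λ (π : Permutation′ N) → ∀ k → π ⟨$⟩ʳ inject≤ k t≤N ≡ g k
extend-injection {t = zero} _ _ = id , λ ()
extend-injection {suc N} {suc t} {g} g-inj (s≤s t≤N) = insert zero (g zero) π , extends
  where
  g₀≢g : ∀ k → g zero ≢ g (suc k)
  g₀≢g k g₀≡g = case g-inj g₀≡g of λ ()
  g′ : Fin t → Fin N
  g′ k = punchOut (g₀≢g k)
  g′-inj : Injective _≡_ _≡_ g′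
  g′-inj g′≡ = suc-injective (g-inj (punchOut-injective (g₀≢g _) (g₀≢g _) g′≡))
  π = proj₁ (extend-injection g′-inj t≤N)
  extends : ∀ k → insert zero (g zero) π ⟨$⟩ʳ inject≤ k (s≤s t≤N) ≡ g k
  extends zero    = refl
  extends (suc k) = trans (cong (punchIn (g zero)) (proj₂ (extend-injection g′-inj t≤N) k))
                          (punchIn-punchOut (g₀≢g k))

allSubsets : ∀ s → List (Subset s)
allSubsets zero    = [ [] ]
allSubsets (suc s) = List.map (true ∷_) (allSubsets s) List.++ List.map (false ∷_) (allSubsets s)

∈-allSubsets : (p : Subset s) → p ∈ allSubsets s
∈-allSubsets []          = here refl
∈-allSubsets (true ∷ p)  = ∈-++⁺ˡ (∈-map⁺ (true ∷_) (∈-allSubsets p))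
∈-allSubsets (false ∷ p) = ∈-++⁺ʳ _ (∈-map⁺ (false ∷_) (∈-allSubsets p))

Traces : (Fin s → Fin N) → Subset N → Subset s → Set
Traces g h A = ∀ k → lookup h (g k) ≡ lookup A k

TracedBy : Colouring N → Bool → ℕ → (Fin s → Fin N) → Subset s → Set
TracedBy c col r g A = ∃ λ h → ∣ h ∣ ≡ r × c h ≡ col × Traces g h A

AllTraces : Colouring N → Bool → (m r : ℕ) → (Fin s → Fin N) → Set
AllTraces c col m r g = ∀ A → ∣ A ∣ ≡ m → TracedBy c col r g A

restrict-preimage : {t M : ℕ} {f : Fin N → Fin M} {g : Fin t → Fin M} .(t≤N : t ≤ N) →
                    (∀ k → f (inject≤ k t≤N) ≡ g k) → {h : Subset M} {A : Subset t} →
                    Traces g h A → restrict t≤N (preimage f h) ≡ A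
restrict-preimage {f = f} {g} t≤N f≡g {h} {A} h-traces = lookup-ext λ k → begin
  lookup (restrict t≤N (preimage f h)) k   ≡⟨ lookup∘tabulate _ k ⟩
  lookup (preimage f h) (inject≤ k t≤N)    ≡⟨ lookup∘tabulate _ (inject≤ k t≤N) ⟩
  lookup h (f (inject≤ k t≤N))             ≡⟨ cong (lookup h) (f≡g k) ⟩
  lookup h (g k)                           ≡⟨ h-traces k ⟩
  lookup A k                               ∎

copy-of-TK : {t : ℕ} (c : Colouring N) (col : Bool) (m r : ℕ) {g : Fin t → Fin N} →
             Injective _≡_ _≡_ g → AllTraces c col m r g → ∃ λ H → TK m t r H × HasCopy c col H
copy-of-TK {N} {t} c col m r {g} g-inj traced =
  hg N edges , (t≤N , proj₁ ∘ edge , proj₁ ∘ proj₂ ∘ edge , onto) ,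
  (π ⟨$⟩ʳ_ , ⟨$⟩ʳ-injective π , proj₂ ∘ proj₂ ∘ edge)
  where
  t≤N : t ≤ N
  t≤N = injective⇒≤ g-inj
  -- π moves the first t vertices onto the image of g, so H is the hypergraph of
  -- col-coloured r-sets with m-point trace on that image, pulled back along π.
  π : Permutation′ N
  π = proj₁ (extend-injection g-inj t≤N)
  π-extends-g : ∀ k → π ⟨$⟩ʳ inject≤ k t≤N ≡ g k
  π-extends-g = proj₂ (extend-injection g-inj t≤N)
  IsEdge : Subset N → Set
  IsEdge e = ∣ e ∣ ≡ r × ∣ restrict t≤N e ∣ ≡ m × c (image (π ⟨$⟩ʳ_) e) ≡ col
  isEdge? : ∀ e → Dec (IsEdge e)
  isEdge? e =
    (∣ e ∣ ℕ.≟ r) ×-dec (∣ restrict t≤N e ∣ ℕ.≟ m) ×-dec (c (image (π ⟨$⟩ʳ_) e) Bool.≟ col)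
  edges : List (Subset N)
  edges = List.filter isEdge? (allSubsets N)
  edge : ∀ {e} → e ∈ edges → IsEdge e
  edge e∈ = proj₂ (∈-filter⁻ isEdge? {xs = allSubsets N} e∈)
  edge-of-trace : ∀ {A} → ∣ A ∣ ≡ m → TracedBy c col r g A → ∃ λ e → e ∈ edges × restrict t≤N e ≡ A
  edge-of-trace {A} ∣A∣≡m (h , ∣h∣≡r , ch≡col , h-traces) =
    e , ∈-filter⁺ isEdge? (∈-allSubsets e) e-is-edge , e-restricts
    where
    e = preimage (π ⟨$⟩ʳ_) h
    e-image : image (π ⟨$⟩ʳ_) e ≡ h
    e-image = image-preimage π h
    e-restricts : restrict t≤N e ≡ A
    e-restricts = restrict-preimage {f = π ⟨$⟩ʳ_} t≤N π-extends-g {h} h-traces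
    ∣e∣≡r : ∣ e ∣ ≡ r
    ∣e∣≡r = trans (sym (∣image∣ (⟨$⟩ʳ-injective π) e)) (trans (cong ∣_∣ e-image) ∣h∣≡r)
    e-is-edge : IsEdge e
    e-is-edge = ∣e∣≡r , trans (cong ∣_∣ e-restricts) ∣A∣≡m , trans (cong c e-image) ch≡col
  onto : ∀ A → ∣ A ∣ ≡ m → ∃ λ e → e ∈ edges × restrict t≤N e ≡ A
  onto A ∣A∣≡m = edge-of-trace ∣A∣≡m (traced A ∣A∣≡m)

Forces : Colouring N → Bool → ℕ → (Fin s → Fin N) → Subset s → Set
Forces c col r g A = ∀ h → ∣ h ∣ ≡ r → Traces g h A → c h ≡ col

tracedBy? : (c : Colouring N) (col : Bool) (r : ℕ) (g : Fin s → Fin N) (A : Subset s) →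
            Dec (TracedBy c col r g A)
tracedBy? c col r g A = anySubset? λ h →
  (∣ h ∣ ℕ.≟ r) ×-dec (c h Bool.≟ col) ×-dec all? (λ k → lookup h (g k) Bool.≟ lookup A k)

allTraces-or-forced : (c : Colouring N) (col : Bool) (m r : ℕ) (g : Fin s → Fin N) →
                      AllTraces c col m r g ⊎ ∃ λ A → ∣ A ∣ ≡ m × Forces c (not col) r g A
allTraces-or-forced c col m r g with anySubset? (λ A → (∣ A ∣ ℕ.≟ m) ×-dec ¬? (tracedBy? c col r g A))
... | yes (A , ∣A∣≡m , untraced) =
  inj₂ (A , ∣A∣≡m , λ h ∣h∣≡r h-traces → ¬-not λ ch≡col → untraced (h , ∣h∣≡r , ch≡col , h-traces))
... | no none =
  inj₁ λ A ∣A∣≡m → decidable-stable (tracedBy? c col r g A) λ untraced → none (A , ∣A∣≡m , untraced)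

glue-traces : {s′ : ℕ} {g : Fin s → Fin N} {g′ : Fin s′ → Fin N} →
              Injective _≡_ _≡_ g → Injective _≡_ _≡_ g′ →
              {y : Fin s} {x : Fin s′} → g y ≡ g′ x → (∀ k k′ → g k ≡ g′ k′ → k′ ≡ x) →
              {B : Subset s} {A : Subset s′} → lookup B y ≡ true → lookup A x ≡ true →
              ∃ λ h → Traces g h B × Traces g′ h A × suc ∣ h ∣ ≡ ∣ B ∣ + ∣ A ∣
glue-traces {g = g} {g′} g-inj g′-inj {y} {x} gy≡g′x meet {B} {A} y∈B x∈A =
  h , traces-B , traces-A , size
  where
  A′ = A [ x ]≔ false
  gB = image g B
  g′A′ = image g′ A′
  h = gB ∪ g′A′
  g′A′-misses-g : ∀ k → lookup g′A′ (g k) ≡ false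
  g′A′-misses-g k = lookup-image-false⁺ g′ A′ λ i g′i≡gk →
    subst (λ z → lookup A′ z ≡ false) (sym (meet k i (sym g′i≡gk))) (lookup∘update x A false)
  gB-misses-g′ : ∀ {k′} → k′ ≢ x → lookup gB (g′ k′) ≡ false
  gB-misses-g′ k′≢x = lookup-image-false⁺ g B λ i gi≡g′k′ → ⊥-elim (k′≢x (meet i _ gi≡g′k′))
  traces-B : Traces g h B
  traces-B k = begin
    lookup h (g k)                         ≡⟨ lookup-zipWith _∨_ (g k) gB g′A′ ⟩
    lookup gB (g k) ∨ lookup g′A′ (g k)    ≡⟨ cong₂ _∨_ (lookup-image-injective g g-inj B k) (g′A′-misses-g k) ⟩
    lookup B k ∨ false                     ≡⟨ ∨-identityʳ _ ⟩
    lookup B k                             ∎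
  traces-A : Traces g′ h A
  traces-A k′ with k′ ≟ x
  ... | yes refl = begin
    lookup h (g′ x)   ≡⟨ cong (lookup h) gy≡g′x ⟨
    lookup h (g y)    ≡⟨ traces-B y ⟩
    lookup B y        ≡⟨ trans y∈B (sym x∈A) ⟩
    lookup A x        ∎
  ... | no k′≢x = begin
    lookup h (g′ k′)                       ≡⟨ lookup-zipWith _∨_ (g′ k′) gB g′A′ ⟩
    lookup gB (g′ k′) ∨ lookup g′A′ (g′ k′) ≡⟨ cong₂ _∨_ (gB-misses-g′ k′≢x) (lookup-image-injective g′ g′-inj A′ k′) ⟩
    lookup A′ k′                           ≡⟨ lookup∘update′ k′≢x A false ⟩
    lookup A k′                            ∎
  disjoint : ∀ v → lookup gB v ∧ lookup g′A′ v ≡ false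
  disjoint v with lookup gB v in v∈gB
  ... | false = refl
  ... | true with lookup-image-true⁻ g B v∈gB
  ...   | k , _ , refl = g′A′-misses-g k
  size : suc ∣ h ∣ ≡ ∣ B ∣ + ∣ A ∣
  size = begin
    suc ∣ h ∣                 ≡⟨ cong suc (∣p∪q∣≡∣p∣+∣q∣ gB g′A′ disjoint) ⟩
    suc (∣ gB ∣ + ∣ g′A′ ∣)   ≡⟨ cong₂ (λ m n → suc (m + n)) (∣image∣ g-inj B) (∣image∣ g′-inj A′) ⟩
    suc (∣ B ∣ + ∣ A′ ∣)      ≡⟨ +-suc ∣ B ∣ ∣ A′ ∣ ⟨
    ∣ B ∣ + suc ∣ A′ ∣        ≡⟨ cong (∣ B ∣ +_) (∣p∣≡suc∣p[x]≔false∣ A x∈A) ⟨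
    ∣ B ∣ + ∣ A ∣             ∎

n≡m+1⇒m<n : {m n : ℕ} → n ≡ m + 1 → m < n
n≡m+1⇒m<n {m} n≡m+1 = ≤-reflexive (sym (trans n≡m+1 (+-comm m 1)))

∃-or-∀ : {P Q : Fin s → Set} → (∀ i → P i ⊎ Q i) → ∃ P ⊎ (∀ i → Q i)
∃-or-∀ {zero}  _      = inj₂ λ ()
∃-or-∀ {suc s} P-or-Q with P-or-Q zero | ∃-or-∀ (P-or-Q ∘ suc)
... | inj₁ P₀ | _             = inj₁ (zero , P₀)
... | inj₂ _  | inj₁ (i , Pᵢ) = inj₁ (suc i , Pᵢ)
... | inj₂ Q₀ | inj₂ Q        = inj₂ λ where
  zero    → Q₀
  (suc i) → Q i

m<∣p∣⇒∃↑ʳ : ∀ m {n} (p : Subset (m + n)) → m < ∣ p ∣ → ∃ λ j → lookup p (m ↑ʳ j) ≡ true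
m<∣p∣⇒∃↑ʳ zero    (true  ∷ p) _         = zero , refl
m<∣p∣⇒∃↑ʳ zero    (false ∷ p) 0<∣p∣     = let j , pⱼ = m<∣p∣⇒∃↑ʳ zero p 0<∣p∣ in suc j , pⱼ
m<∣p∣⇒∃↑ʳ (suc m) (true  ∷ p) (s≤s m<∣p∣) = m<∣p∣⇒∃↑ʳ m p m<∣p∣
m<∣p∣⇒∃↑ʳ (suc m) (false ∷ p) m<∣p∣     = m<∣p∣⇒∃↑ʳ m p (<-trans (n<1+n m) m<∣p∣)

data Split (m n : ℕ) : Fin (m + n) → Set where
  left  : (i : Fin m) → Split m n (i ↑ˡ n)
  right : (j : Fin n) → Split m n (m ↑ʳ j)

split : ∀ m {n} (k : Fin (m + n)) → Split m n k
split zero    k       = right k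
split (suc m) zero    = left zero
split (suc m) (suc k) with split m k
... | left i  = left (suc i)
... | right j = right j

++-injective : {m n : ℕ} {V : Set} {f : Fin m → V} {g : Fin n → V} →
               Injective _≡_ _≡_ f → Injective _≡_ _≡_ g → (∀ i j → f i ≢ g j) →
               Injective _≡_ _≡_ (f ++ g)
++-injective {m} {n} {f = f} {g} f-inj g-inj f≢g {k} {k′} = go (split m k) (split m k′)
  where
  via : {V : Set} {u u′ w w′ : V} → u ≡ w → u′ ≡ w′ → u ≡ u′ → w ≡ w′
  via u≡w u′≡w′ u≡u′ = trans (sym u≡w) (trans u≡u′ u′≡w′)
  go : ∀ {k k′} → Split m n k → Split m n k′ → (f ++ g) k ≡ (f ++ g) k′ → k ≡ k′
  go (left i)  (left i′)  eq = cong (_↑ˡ n) (f-inj (via (lookup-++ˡ f g i) (lookup-++ˡ f g i′) eq))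
  go (left i)  (right j′) eq = ⊥-elim (f≢g i j′ (via (lookup-++ˡ f g i) (lookup-++ʳ f g j′) eq))
  go (right j) (left i′)  eq = ⊥-elim (f≢g i′ j (via (lookup-++ˡ f g i′) (lookup-++ʳ f g j) (sym eq)))
  go (right j) (right j′) eq = cong (m ↑ʳ_) (g-inj (via (lookup-++ʳ f g j) (lookup-++ʳ f g j′) eq))

module Grid (a b p q : ℕ) where

  data Vertex : Set where
    lower : Fin a → Vertex
    upper : Fin b → Vertex
    cell  : Fin p → Fin q → Vertex

  encode : Vertex → Fin (p * q + a + b)
  encode (cell i j) = (combine i j ↑ˡ a) ↑ˡ b
  encode (lower l)  = (p * q ↑ʳ l) ↑ˡ b
  encode (upper u)  = p * q + a ↑ʳ u

  decode : Fin (p * q + a + b) → Vertex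
  decode = ((uncurry cell ∘ remQuot q) ++ lower) ++ upper

  decode-encode : ∀ v → decode (encode v) ≡ v
  decode-encode (cell i j) = begin
    decode ((combine i j ↑ˡ a) ↑ˡ b)                 ≡⟨ lookup-++ˡ _ upper (combine i j ↑ˡ a) ⟩
    ((uncurry cell ∘ remQuot q) ++ lower) (combine i j ↑ˡ a) ≡⟨ lookup-++ˡ _ lower (combine i j) ⟩
    uncurry cell (remQuot q (combine i j))           ≡⟨ cong (uncurry cell) (remQuot-combine i j) ⟩
    cell i j                                         ∎
  decode-encode (lower l) = trans (lookup-++ˡ (uncurry cell ∘ remQuot q ++ lower) upper (p * q ↑ʳ l))
                                  (lookup-++ʳ (uncurry cell ∘ remQuot q) lower l)
  decode-encode (upper u) = lookup-++ʳ (uncurry cell ∘ remQuot q ++ lower) upper u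

  encode-injective : Injective _≡_ _≡_ encode
  encode-injective {v} {w} v≡w = trans (sym (decode-encode v)) (trans (cong decode v≡w) (decode-encode w))

  row : Fin p → Fin (b + q) → Vertex
  row i = upper ++ cell i

  column : (Fin p → Fin q) → Fin (a + p) → Vertex
  column j = lower ++ λ i → cell i (j i)

  row-injective : ∀ i → Injective _≡_ _≡_ (encode ∘ row i)
  row-injective i =
    ++-injective {b} {q} (λ { refl → refl }) (λ { refl → refl }) (λ _ _ ()) ∘ encode-injective

  column-injective : ∀ j → Injective _≡_ _≡_ (encode ∘ column j)
  column-injective j =
    ++-injective {a} {p} (λ { refl → refl }) (λ { refl → refl }) (λ _ _ ()) ∘ encode-injective

  row≢lower : ∀ {i} k {l} → row i k ≢ lower l
  row≢lower {i} k with split b k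
  ... | left u  = λ row≡lower → case trans (sym (lookup-++ˡ upper (cell i) u)) row≡lower of λ ()
  ... | right j = λ row≡lower → case trans (sym (lookup-++ʳ upper (cell i) j)) row≡lower of λ ()

  row≡cell⇒≡ : ∀ {i} k {i′ j′} → row i k ≡ cell i′ j′ → i ≡ i′
  row≡cell⇒≡ {i} k with split b k
  ... | left u  = λ row≡cell → case trans (sym (lookup-++ˡ upper (cell i) u)) row≡cell of λ ()
  ... | right j = λ row≡cell → case trans (sym (lookup-++ʳ upper (cell i) j)) row≡cell of λ { refl → refl }

  row-meets-column : ∀ {i j} k k′ → row i k ≡ column j k′ → k′ ≡ a ↑ʳ i
  row-meets-column {i} {j} k k′ row≡column with split a k′
  ... | left l   = ⊥-elim (row≢lower k (trans row≡column (lookup-++ˡ lower _ l)))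
  ... | right i′ = cong (a ↑ʳ_) (sym (row≡cell⇒≡ k (trans row≡column (lookup-++ʳ lower _ i′))))

  row≡column : ∀ i j → row i (b ↑ʳ j i) ≡ column j (a ↑ʳ i)
  row≡column i j = trans (lookup-++ʳ upper (cell i) (j i)) (sym (lookup-++ʳ lower _ i))

  forced-rows⇒traced-column : (c : Colouring (p * q + a + b)) →
    (∀ i → ∃ λ B → ∣ B ∣ ≡ b + 1 × Forces c true (a + b + 1) (encode ∘ row i) B) →
    ∃ λ j → AllTraces c true (a + 1) (a + b + 1) (encode ∘ column j)
  forced-rows⇒traced-column c forced = j , traced
    where
    B : Fin p → Subset (b + q)
    B i = proj₁ (forced i)
    cell-in-B : ∀ i → ∃ λ j → lookup (B i) (b ↑ʳ j) ≡ true
    cell-in-B i = m<∣p∣⇒∃↑ʳ b (B i) (n≡m+1⇒m<n (proj₁ (proj₂ (forced i))))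
    j : Fin p → Fin q
    j = proj₁ ∘ cell-in-B
    traced : AllTraces c true (a + 1) (a + b + 1) (encode ∘ column j)
    traced A ∣A∣≡a+1 =
      let i , a↑ʳi∈A           = m<∣p∣⇒∃↑ʳ a A (n≡m+1⇒m<n ∣A∣≡a+1)
          ∣Bᵢ∣≡b+1 , Bᵢ-forces = proj₂ (forced i)
          h , traces-B , traces-A , size =
            glue-traces (row-injective i) (column-injective j) (cong encode (row≡column i j))
                        (λ k k′ → row-meets-column k k′ ∘ encode-injective)
                        {B i} {A} (proj₂ (cell-in-B i)) a↑ʳi∈A
          ∣h∣≡r = ℕ.suc-injective (trans size (trans (cong₂ _+_ ∣Bᵢ∣≡b+1 ∣A∣≡a+1) (arith a b)))
      in h , ∣h∣≡r , Bᵢ-forces h ∣h∣≡r traces-B , traces-A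
      where
      arith : ∀ a b → (b + 1) + (a + 1) ≡ suc (a + b + 1)
      arith = solve-∀

  ramsey-grid : RamseyProperty (a + b + 1) (TK (a + 1) (a + p) (a + b + 1)) (TK (b + 1) (b + q) (a + b + 1))
                               (p * q + a + b)
  ramsey-grid c with ∃-or-∀ (λ i → allTraces-or-forced c false (b + 1) (a + b + 1) (encode ∘ row i))
  ... | inj₁ (i , traced) = inj₂ (copy-of-TK c false (b + 1) (a + b + 1) (row-injective i) traced)
  ... | inj₂ forced       =
    let j , traced = forced-rows⇒traced-column c forced
    in inj₁ (copy-of-TK c true (a + 1) (a + b + 1) (column-injective j) traced)

theorem4p2 : (a b t s : ℕ) → 1 ≤ a → 1 ≤ b → a + 1 ≤ t → b + 1 ≤ s →
    RamseyLE (a + b + 1) (TK (a + 1) t (a + b + 1)) (TK (b + 1) s (a + b + 1))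
      ((t ∸ a) * (s ∸ b) + a + b)
-- The bound does not need a, b ≥ 1.
theorem4p2 a b t s _ _ a+1≤t b+1≤s = (t ∸ a) * (s ∸ b) + a + b , ≤-refl ,
  subst₂ (λ t′ s′ → RamseyProperty (a + b + 1) (TK (a + 1) t′ (a + b + 1)) (TK (b + 1) s′ (a + b + 1))
                                   ((t ∸ a) * (s ∸ b) + a + b))
         (m+[n∸m]≡n (≤-trans (m≤m+n a 1) a+1≤t)) (m+[n∸m]≡n (≤-trans (m≤m+n b 1) b+1≤s))
         (Grid.ramsey-grid a b (t ∸ a) (s ∸ b))
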